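{- Let $m,n$ be positive integers with $n>m\ge 6$ and $2\nmid mn$. Then $$r(K_{1,m-1},T_n^1)=r(K_{1,m-1},T_n^2)=m+n-5.$$
   Context: All graphs are finite simple graphs. For graphs $G_1,G_2$, the Ramsey number $r(G_1,G_2)$ is the smallest positive integer $N$ such that for every graph $G$ on $N$ vertices, either $G$ contains a (not necessarily induced) subgraph isomorphic to $G_1$, or the complement $\overline{G}$ contains a subgraph isomorphic to $G_2$. $K_{1,m-1}$ is the star on $m$ vertices. For $n\ge 5$, with vertex set $\{v_0,v_1,\ldots,v_{n-1}\}$: $T_n^1$ is the tree with edges $v_0v_1,\ldots,v_0v_{n-3},v_{n-4}v_{n-2},v_{n-3}v_{n-1}$; $T_n^2$ is the tree with edges $v_0v_1,\ldots,v_0v_{n-3},v_{n-3}v_{n-2},v_{n-3}v_{n-1}$. -}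

module Defs where

open import Data.Nat using (ℕ; zero; suc; _+_; _∸_; _<_; _≤_)
open import Data.Fin using (Fin; toℕ; fromℕ<)
open import Data.Bool using (Bool; true; false; not)
open import Data.List using (List; []; _∷_; map; upTo)
open import Data.List.Relation.Unary.All using (All)
open import Data.Product using (Σ; _×_; _,_)
open import Data.Sum using (_⊎_)
open import Relation.Binary.PropositionalEquality using (_≡_; _≢_)
open import Relation.Nullary using (¬_)
open import Function.Definitions using (Injective)
open import Data.Nat.Properties using (≤-refl)

record Graph (n : ℕ) : Set where
  field
    adj   : Fin n → Fin n → Bool
    sym   : ∀ u v → adj u v ≡ adj v u
    irrefl : ∀ v → adj v v ≡ false
open Graph public

open import Data.Fin using (_≟_)
open import Relation.Nullary using (yes; no)
open import Relation.Binary.PropositionalEquality using (refl; cong)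


compAdj : ∀ {n} → Graph n → Fin n → Fin n → Bool
compAdj G u v with u ≟ v
... | yes _ = false
... | no  _ = not (adj G u v)

private
  compSym : ∀ {n} (G : Graph n) u v → compAdj G u v ≡ compAdj G v u
  compSym G u v with u ≟ v | v ≟ u
  ... | yes _ | yes _ = refl
  ... | yes refl | no ne = Data.Empty.⊥-elim (ne refl)
    where import Data.Empty
  ... | no ne | yes refl = Data.Empty.⊥-elim (ne refl)
    where import Data.Empty
  ... | no _ | no _ = cong not (Graph.sym G u v)

  compIrr : ∀ {n} (G : Graph n) v → compAdj G v v ≡ false
  compIrr G v with v ≟ v
  ... | yes _ = refl
  ... | no ne = Data.Empty.⊥-elim (ne refl)
    where import Data.Empty

complement : ∀ {n} → Graph n → Graph n
complement G = record { adj = compAdj G ; sym = compSym G ; irrefl = compIrr G }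

_⊆G_ : ∀ {k n} → Graph k → Graph n → Set
_⊆G_ {k} {n} H G =
  Σ (Fin k → Fin n) λ f → Injective _≡_ _≡_ f ×
    (∀ u v → adj H u v ≡ true → adj G (f u) (f v) ≡ true)

RamseyProp : ∀ {a b} → Graph a → Graph b → ℕ → Set
RamseyProp G₁ G₂ N = (G : Graph N) → (G₁ ⊆G G) ⊎ (G₂ ⊆G complement G)

IsRamseyNumber : ∀ {a b} → Graph a → Graph b → ℕ → Set
IsRamseyNumber G₁ G₂ r =
  0 < r × RamseyProp G₁ G₂ r × (∀ N → 0 < N → N < r → ¬ RamseyProp G₁ G₂ N)

open import Data.Bool using (_∨_; _∧_)
open import Data.Nat using (_≡ᵇ_; _≤ᵇ_)
open import Data.Bool.Properties using (∨-comm; ∧-zeroˡ)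

neqb : ∀ {n} → Fin n → Fin n → Bool
neqb u v with u ≟ v
... | yes _ = false
... | no  _ = true

private
  neqb-sym : ∀ {n} (u v : Fin n) → neqb u v ≡ neqb v u
  neqb-sym u v with u ≟ v | v ≟ u
  ... | yes _ | yes _ = refl
  ... | yes refl | no ne = Data.Empty.⊥-elim (ne refl)
    where import Data.Empty
  ... | no ne | yes refl = Data.Empty.⊥-elim (ne refl)
    where import Data.Empty
  ... | no _ | no _ = refl

  neqb-irr : ∀ {n} (v : Fin n) → neqb v v ≡ false
  neqb-irr v with v ≟ v
  ... | yes _ = refl
  ... | no ne = Data.Empty.⊥-elim (ne refl)
    where import Data.Empty

fromEdges : ∀ n → (ℕ → ℕ → Bool) → Graph n
fromEdges n e = record
  { adj = λ u v → neqb u v ∧ (e (toℕ u) (toℕ v) ∨ e (toℕ v) (toℕ u))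
  ; sym = λ u v → Relation.Binary.PropositionalEquality.cong₂ _∧_ (neqb-sym u v)
                    (∨-comm (e (toℕ u) (toℕ v)) (e (toℕ v) (toℕ u)))
  ; irrefl = λ v → Relation.Binary.PropositionalEquality.cong (_∧ (e (toℕ v) (toℕ v) ∨ e (toℕ v) (toℕ v))) (neqb-irr v)
  }
  where import Relation.Binary.PropositionalEquality

starEdge : ℕ → ℕ → Bool
starEdge i j = (i ≡ᵇ 0) ∧ (1 ≤ᵇ j)

-- T_n^1 on v₀,…,v_{n-1}: edges v₀v₁,…,v₀v_{n-3}, v_{n-4}v_{n-2}, v_{n-3}v_{n-1}.
T1Edge : ℕ → ℕ → ℕ → Bool
T1Edge n i j =
  ((i ≡ᵇ 0) ∧ ((1 ≤ᵇ j) ∧ (j ≤ᵇ n ∸ 3)))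
  ∨ (((i ≡ᵇ n ∸ 4) ∧ (j ≡ᵇ n ∸ 2)) ∨ ((i ≡ᵇ n ∸ 3) ∧ (j ≡ᵇ n ∸ 1)))

-- T_n^2 on v₀,…,v_{n-1}: edges v₀v₁,…,v₀v_{n-3}, v_{n-3}v_{n-2}, v_{n-3}v_{n-1}.
T2Edge : ℕ → ℕ → ℕ → Bool
T2Edge n i j =
  ((i ≡ᵇ 0) ∧ ((1 ≤ᵇ j) ∧ (j ≤ᵇ n ∸ 3)))
  ∨ (((i ≡ᵇ n ∸ 3) ∧ (j ≡ᵇ n ∸ 2)) ∨ ((i ≡ᵇ n ∸ 3) ∧ (j ≡ᵇ n ∸ 1)))

T1 : (n : ℕ) → Graph n
T1 n = fromEdges n (T1Edge n)

T2 : (n : ℕ) → Graph n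
T2 n = fromEdges n (T2Edge n)

KStar : (m : ℕ) → Graph m
KStar m = fromEdges m starEdge

-- Write m = j + 2 and n = k + 4: the star is K_{1,j+1}, both trees have a vertex of degree
-- k + 1, and m + n − 5 = j + k + 1.
--
-- Lower bound: on N ≤ j + k vertices join u ≠ v when u + v mod N is below j. Since u + v
-- determines v, every vertex has at most j neighbours and at most N − j ≤ k non-neighbours.
--
-- Upper bound: if G on j + k + 1 vertices has no K_{1,j+1}, every vertex has at least k
-- non-neighbours, and as (j + k + 1) j is odd G is not j-regular, so some vertex c has
-- d ≥ k + 1 non-neighbours. The tree is grown in the complement with hub c. For d ≥ k + 3 this
-- is greedy. Otherwise c has μ = j + k − d ≥ 2 neighbours, each adjacent to at most j − 1
-- non-neighbours of c and so missing at least two of them, which gives T_n^1. Double counting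
-- the edges between the non-neighbours and the neighbours of c (using j ≥ 5) produces a
-- non-neighbour of c that misses two neighbours of c, which gives T_n^2.

module Submission where

open import Defs hiding (sym)
open import Data.Nat.Properties hiding (_≟_)
open import Algebra.Properties.CommutativeMonoid.Sum +-0-commutativeMonoid
  using (sum; sum-syntax; ∑-distrib-+; ∑-comm; sum-cong-≗)
open import Data.Bool using (Bool; true; false; not; _∧_; _∨_; if_then_else_; T)
import Data.Bool as Bool
open import Data.Bool.Properties using (∧-zeroʳ; ∧-identityˡ; ∨-idem; T-≡)
open import Data.Empty using (⊥-elim)
open import Data.Fin using (Fin; zero; suc; toℕ; fromℕ<; _≟_; lift; inject₁; #_)
import Data.Fin.Properties as Fin
open import Data.Nat using (ℕ; zero; suc; _+_; _*_; _∸_; _<_; _≤_; z≤n; s≤s; s≤s⁻¹; _<ᵇ_; _≤ᵇ_; _≡ᵇ_; _<?_; _≤?_)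
open import Data.Nat.DivMod using (_/_; _%_; m%n<n; m≡m%n+[m/n]*n; [m+kn]%n≡m%n)
open import Data.Nat.Divisibility using (_∣_; divides; _∣0; ∣m∣n⇒∣m+n; n∣m⇒m%n≡0; ∣m⇒∣m*n; ∣n⇒∣m*n)
open import Data.Nat.Tactic.RingSolver using (solve-∀)
open import Data.Product using (Σ; ∃; _×_; _,_; proj₁; proj₂)
open import Data.Sum using (_⊎_; inj₁; inj₂)
open import Data.Vec using (Vec; []; _∷_; _++_; lookup)
open import Data.Vec.Relation.Unary.All using (All; []; _∷_)
open import Data.Vec.Relation.Unary.All.Properties using (lookup⁺; ++⁺)
open import Data.Vec.Relation.Unary.AllPairs using ([]; _∷_)
open import Data.Vec.Relation.Unary.Unique.Propositional using (Unique)
open import Data.Vec.Relation.Unary.Unique.Propositional.Properties using (lookup-injective)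
open import Function using (_∘_)
open import Function.Bundles using (Equivalence)
open import Function.Definitions using (Injective)
open import Relation.Binary.PropositionalEquality
open import Relation.Nullary using (¬_; yes; no; does)
open import Relation.Nullary.Decidable using (_×-dec_)

∧-split : ∀ {a b} → a ∧ b ≡ true → a ≡ true × b ≡ true
∧-split {true} b≡true = refl , b≡true

∨-split : ∀ {a b} → a ∨ b ≡ true → a ≡ true ⊎ b ≡ true
∨-split {true}  _ = inj₁ refl
∨-split {false} b = inj₂ b

∨-introˡ : ∀ {a b} → a ≡ true → a ∨ b ≡ true
∨-introˡ refl = refl

≡ᵇ-true⇒≡ : ∀ {m n} → (m ≡ᵇ n) ≡ true → m ≡ n
≡ᵇ-true⇒≡ {m} {n} m≡ᵇn = ≡ᵇ⇒≡ m n (Equivalence.from T-≡ m≡ᵇn)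

≤ᵇ-true⇒≤ : ∀ {m n} → (m ≤ᵇ n) ≡ true → m ≤ n
≤ᵇ-true⇒≤ {m} {n} m≤ᵇn = ≤ᵇ⇒≤ m n (Equivalence.from T-≡ m≤ᵇn)

<⇒<ᵇ-true : ∀ {m n} → m < n → (m <ᵇ n) ≡ true
<⇒<ᵇ-true m<n = Equivalence.to T-≡ (<⇒<ᵇ m<n)

<ᵇ-true⇒< : ∀ {m n} → (m <ᵇ n) ≡ true → m < n
<ᵇ-true⇒< {m} {n} m<ᵇn = <ᵇ⇒< m n (Equivalence.from T-≡ m<ᵇn)

<ᵇ-false⇒≥ : ∀ {m n} → (m <ᵇ n) ≡ false → n ≤ m
<ᵇ-false⇒≥ m≮ᵇn = ≮⇒≥ (λ m<n → subst T m≮ᵇn (<⇒<ᵇ m<n))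

≢⇒neqb : ∀ {N} {u v : Fin N} → u ≢ v → neqb u v ≡ true
≢⇒neqb {u = u} {v} u≢v with u ≟ v
... | yes u≡v = ⊥-elim (u≢v u≡v)
... | no  _   = refl

sum-mono-≤ : ∀ {N} {f g : Fin N → ℕ} → (∀ v → f v ≤ g v) → sum f ≤ sum g
sum-mono-≤ {zero}  _   = z≤n
sum-mono-≤ {suc N} f≤g = +-mono-≤ (f≤g zero) (sum-mono-≤ (f≤g ∘ suc))

∑-const : ∀ N k → ∑[ v < N ] k ≡ N * k
∑-const zero    k = refl
∑-const (suc N) k = cong (k +_) (∑-const N k)

count : ∀ {N} → (Fin N → Bool) → ℕ
count {N} P = ∑[ v < N ] (if P v then 1 else 0)

_⊆ᵇ_ : ∀ {N} → (Fin N → Bool) → (Fin N → Bool) → Set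
P ⊆ᵇ Q = ∀ v → P v ≡ true → Q v ≡ true

count-cong : ∀ {N} {P Q : Fin N → Bool} → (∀ v → P v ≡ Q v) → count P ≡ count Q
count-cong P≗Q = sum-cong-≗ (λ v → cong (λ b → if b then 1 else 0) (P≗Q v))

count-mono : ∀ {N} {P Q : Fin N → Bool} → P ⊆ᵇ Q → count P ≤ count Q
count-mono {P = P} {Q} P⊆Q = sum-mono-≤ pointwise
  where
  pointwise : ∀ v → (if P v then 1 else 0) ≤ (if Q v then 1 else 0)
  pointwise v with P v | P⊆Q v
  ... | false | _   = z≤n
  ... | true  | Q[v] rewrite Q[v] refl = ≤-refl

count-all : ∀ N → count {N} (λ _ → true) ≡ N
count-all N = trans (∑-const N 1) (*-identityʳ N)

count-none : ∀ N → count {N} (λ _ → false) ≡ 0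
count-none N = trans (∑-const N 0) (*-zeroʳ N)

count-split : ∀ {N} (P Q : Fin N → Bool) →
  count P ≡ count (λ v → P v ∧ Q v) + count (λ v → P v ∧ not (Q v))
count-split P Q = trans (sum-cong-≗ pointwise)
  (∑-distrib-+ (λ v → if P v ∧ Q v then 1 else 0) (λ v → if P v ∧ not (Q v) then 1 else 0))
  where
  pointwise : ∀ v → (if P v then 1 else 0)
    ≡ (if P v ∧ Q v then 1 else 0) + (if P v ∧ not (Q v) then 1 else 0)
  pointwise v with P v | Q v
  ... | false | _     = refl
  ... | true  | true  = refl
  ... | true  | false = refl

∑-indicator : ∀ {N} (P : Fin N → Bool) n → ∑[ v < N ] (if P v then n else 0) ≡ count P * n
∑-indicator {zero}  P n = refl
∑-indicator {suc N} P n with P zero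
... | true  = cong (n +_) (∑-indicator (P ∘ suc) n)
... | false = ∑-indicator (P ∘ suc) n

if-count : ∀ {N} b (P : Fin N → Bool) → (if b then count P else 0) ≡ count (λ v → b ∧ P v)
if-count {N} false P = sym (count-none N)
if-count true  P = refl

count-≟ : ∀ {N} (a : Fin N) → count (λ v → does (a ≟ v)) ≡ 1
count-≟ {suc N} zero    = cong suc (count-none N)
count-≟ {suc N} (suc a) = count-≟ a

_─_ : ∀ {N} → (Fin N → Bool) → Fin N → Fin N → Bool
(P ─ a) v = P v ∧ not (does (a ≟ v))

─-sound : ∀ {N} {P : Fin N → Bool} {a v} → (P ─ a) v ≡ true → P v ≡ true × a ≢ v
─-sound {P = P} {a} {v} Pv∧a≢v with a ≟ v
... | no a≢v = proj₁ (∧-split Pv∧a≢v) , a≢v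
... | yes _ with () ← proj₂ (∧-split {P v} Pv∧a≢v)

─-complete : ∀ {N} {P : Fin N → Bool} {a v} → P v ≡ true → a ≢ v → (P ─ a) v ≡ true
─-complete {a = a} {v} Pv a≢v with a ≟ v
... | yes a≡v = ⊥-elim (a≢v a≡v)
... | no  _   rewrite Pv = refl

count-─ : ∀ {N} (P : Fin N → Bool) a → count P ≤ suc (count (P ─ a))
count-─ P a = begin
  count P                                                     ≡⟨ count-split P (λ v → does (a ≟ v)) ⟩
  count (λ v → P v ∧ does (a ≟ v)) + count (P ─ a)            ≤⟨ +-monoˡ-≤ _ at-most-a ⟩
  suc (count (P ─ a))                                         ∎
  where
  open ≤-Reasoning
  at-most-a : count (λ v → P v ∧ does (a ≟ v)) ≤ 1
  at-most-a = ≤-trans (count-mono {Q = λ v → does (a ≟ v)} (λ v → proj₂ ∘ ∧-split)) (≤-reflexive (count-≟ a))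

count-─-member : ∀ {N} (P : Fin N → Bool) {a} → P a ≡ true → count P ≡ suc (count (P ─ a))
count-─-member P {a} Pa = begin
  count P                                                     ≡⟨ count-split P (λ v → does (a ≟ v)) ⟩
  count (λ v → P v ∧ does (a ≟ v)) + count (P ─ a)            ≡⟨ cong (_+ count (P ─ a)) just-a ⟩
  suc (count (P ─ a))                                         ∎
  where
  open ≡-Reasoning
  restrict : ∀ v → (P v ∧ does (a ≟ v)) ≡ does (a ≟ v)
  restrict v with a ≟ v
  ... | yes refl rewrite Pa = refl
  ... | no  _    = ∧-zeroʳ (P v)
  just-a : count (λ v → P v ∧ does (a ≟ v)) ≡ 1
  just-a = trans (count-cong restrict) (count-≟ a)

count-< : ∀ {N} {P Q : Fin N → Bool} {a} → P ⊆ᵇ Q → Q a ≡ true → P a ≡ false → suc (count P) ≤ count Q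
count-< {P = P} {Q} {a} P⊆Q Qa Pa = ≤-trans (s≤s (count-mono {Q = Q ─ a} P⊆Q─a)) (≤-reflexive (sym (count-─-member Q {a} Qa)))
  where
  P⊆Q─a : P ⊆ᵇ (Q ─ a)
  P⊆Q─a v Pv = ─-complete {P = Q} {a} (P⊆Q v Pv) λ { refl → false≢true (trans (sym Pa) Pv) }
    where
    false≢true : false ≢ true
    false≢true ()

_∖_ : ∀ {N k} → (Fin N → Bool) → Vec (Fin N) k → Fin N → Bool
P ∖ []       = P
P ∖ (x ∷ xs) = (P ∖ xs) ─ x

∖-sound : ∀ {N k} {P : Fin N → Bool} (xs : Vec (Fin N) k) {v} →
  (P ∖ xs) v ≡ true → P v ≡ true × All (_≢ v) xs
∖-sound []       Pv = Pv , []
∖-sound (x ∷ xs) Pv∖ with ─-sound {P = _ ∖ xs} Pv∖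
... | Pv∖xs , x≢v with ∖-sound xs Pv∖xs
...   | Pv , xs≢v = Pv , x≢v ∷ xs≢v

count-∖ : ∀ {N k} (P : Fin N → Bool) (xs : Vec (Fin N) k) → count P ≤ k + count (P ∖ xs)
count-∖ P []       = ≤-refl
count-∖ {k = suc k} P (x ∷ xs) = ≤-trans (count-∖ P xs)
  (≤-trans (+-monoʳ-≤ k (count-─ (P ∖ xs) x)) (≤-reflexive (+-suc k _)))

Distinct : ∀ {N} → ℕ → (Fin N → Bool) → Set
Distinct {N} k P = Σ (Fin k → Fin N) λ f → Injective _≡_ _≡_ f × (∀ i → P (f i) ≡ true)

distinct-zero : ∀ {N} (P : Fin N → Bool) → Distinct 0 P
distinct-zero P = (λ ()) , (λ { {()} }) , (λ ())

count⇒distinct : ∀ {N} (P : Fin N → Bool) k → k ≤ count P → Distinct k P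
count⇒distinct {zero}  P zero    _ = distinct-zero P
count⇒distinct {suc N} P k k≤ with P zero in P0
... | false with count⇒distinct (P ∘ suc) k k≤
...   | f , f-inj , Pf = suc ∘ f , f-inj ∘ Fin.suc-injective , Pf
count⇒distinct {suc N} P zero    k≤ | true = distinct-zero P
count⇒distinct {suc N} P (suc k) k≤ | true with count⇒distinct (P ∘ suc) k (s≤s⁻¹ k≤)
... | f , f-inj , Pf = lift 1 f , Fin.lift-injective f f-inj 1 , λ { zero → P0 ; (suc i) → Pf i }

distinct⇒count : ∀ {N k} (P : Fin N → Bool) → Distinct k P → k ≤ count P
distinct⇒count {k = zero}  P _ = z≤n
distinct⇒count {k = suc k} P (f , f-inj , Pf) = begin
  suc k                   ≤⟨ s≤s (distinct⇒count (P ─ f zero) (f ∘ suc , Fin.suc-injective ∘ f-inj , rest)) ⟩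
  suc (count (P ─ f zero)) ≡⟨ count-─-member P (Pf zero) ⟨
  count P                 ∎
  where
  open ≤-Reasoning
  rest : ∀ i → (P ─ f zero) (f (suc i)) ≡ true
  rest i = ─-complete {P = P} (Pf (suc i)) (λ e → Fin.0≢1+n (f-inj e))

count-≤-injectiveOn : ∀ {N m} (P : Fin N → Bool) (φ : Fin N → ℕ) →
  (∀ v → P v ≡ true → φ v < m) →
  (∀ {v w} → P v ≡ true → P w ≡ true → φ v ≡ φ w → v ≡ w) →
  count P ≤ m
count-≤-injectiveOn P φ φ< φ-inj with count⇒distinct P (count P) ≤-refl
... | e , e-inj , Pe = Fin.injective⇒≤ ψ-inj
  where
  ψ : Fin (count P) → Fin _
  ψ i = fromℕ< (φ< (e i) (Pe i))
  ψ-inj : Injective _≡_ _≡_ ψ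
  ψ-inj {i} {i′} ψi≡ψi′ = e-inj (φ-inj (Pe i) (Pe i′)
    (trans (sym (Fin.toℕ-fromℕ< _)) (trans (cong toℕ ψi≡ψi′) (Fin.toℕ-fromℕ< _))))

count-∖-≥ : ∀ {N k} l (P : Fin N → Bool) (xs : Vec (Fin N) k) → l + k ≤ count P → l ≤ count (P ∖ xs)
count-∖-≥ {k = k} l P xs l+k≤P =
  +-cancelˡ-≤ k l _ (≤-trans (≤-reflexive (+-comm k l)) (≤-trans l+k≤P (count-∖ P xs)))

choose : ∀ {N k} (P : Fin N → Bool) (xs : Vec (Fin N) k) → k < count P →
  ∃ λ v → P v ≡ true × All (_≢ v) xs
choose P xs k<P with count⇒distinct (P ∖ xs) 1 (count-∖-≥ 1 P xs k<P)
... | f , _ , Pf = f zero , ∖-sound xs (Pf zero)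

chooseMany : ∀ {N k} l (P : Fin N → Bool) (xs : Vec (Fin N) k) → l + k ≤ count P → Distinct l (P ∖ xs)
chooseMany l P xs l+k≤P = count⇒distinct (P ∖ xs) l (count-∖-≥ l P xs l+k≤P)

Edge : ∀ {N} → Graph N → Fin N → Fin N → Set
Edge G u v = adj G u v ≡ true

edge-sym : ∀ {N} (G : Graph N) {u v} → Edge G u v → Edge G v u
edge-sym G {u} {v} uv = trans (Graph.sym G v u) uv

edge-≢ : ∀ {N} (G : Graph N) {u v} → Edge G u v → u ≢ v
edge-≢ G {u} uu refl with () ← trans (sym (irrefl G u)) uu

co-edge⇒¬edge : ∀ {N} (G : Graph N) {u v} → Edge (complement G) u v → adj G u v ≡ false
co-edge⇒¬edge G {u} {v} uv with u ≟ v
... | yes _ with () ← uv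
... | no _ with adj G u v
...   | false = refl
...   | true with () ← uv

degree : ∀ {N} → Graph N → Fin N → ℕ
degree G u = count (adj G u)

degree-complement : ∀ {N} (G : Graph N) u → suc (degree G u + degree (complement G) u) ≡ N
degree-complement {N} G u = begin
  suc (degree G u + degree (complement G) u)
    ≡⟨ cong suc (cong₂ _+_ (count-cong loopless) (count-cong complement-pointwise)) ⟨
  suc (count (λ v → others v ∧ adj G u v) + count (λ v → others v ∧ not (adj G u v)))
    ≡⟨ cong suc (count-split others (adj G u)) ⟨
  suc (count others)
    ≡⟨ cong (_+ count others) (count-≟ u) ⟨
  count (λ v → does (u ≟ v)) + count others
    ≡⟨ count-split (λ _ → true) (λ v → does (u ≟ v)) ⟨
  count {N} (λ _ → true)
    ≡⟨ count-all N ⟩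
  N ∎
  where
  open ≡-Reasoning
  others : Fin N → Bool
  others v = not (does (u ≟ v))
  loopless : ∀ v → (others v ∧ adj G u v) ≡ adj G u v
  loopless v with u ≟ v
  ... | yes refl = sym (irrefl G u)
  ... | no  _    = refl
  complement-pointwise : ∀ v → (others v ∧ not (adj G u v)) ≡ adj (complement G) u v
  complement-pointwise v with u ≟ v
  ... | yes _ = refl
  ... | no  _ = refl

count-split-neighbours : ∀ {N} (G : Graph N) (X : Fin N → Bool) {v} → X v ≡ false →
  count X ≡ count (λ w → X w ∧ adj G v w) + count (λ w → X w ∧ adj (complement G) v w)
count-split-neighbours G X {v} Xv = trans (count-split X (adj G v)) (cong (count (λ w → X w ∧ adj G v w) +_) (count-cong pointwise))
  where
  pointwise : ∀ w → (X w ∧ not (adj G v w)) ≡ (X w ∧ adj (complement G) v w)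
  pointwise w with v ≟ w
  ... | yes refl rewrite Xv = refl
  ... | no  _    = refl

dropVertex : ∀ {N} → Graph (suc N) → Graph N
dropVertex G = record
  { adj    = λ u v → adj G (suc u) (suc v)
  ; sym    = λ u v → Graph.sym G (suc u) (suc v)
  ; irrefl = irrefl G ∘ suc
  }

handshake : ∀ {N} (G : Graph N) → 2 ∣ ∑[ u < N ] degree G u
handshake {zero}  G = 2 ∣0
handshake {suc N} G = subst (2 ∣_) (sym degree-sum) (∣m∣n⇒∣m+n (divides c c+c≡c*2) (handshake (dropVertex G)))
  where
  open ≡-Reasoning
  c : ℕ
  c = count (λ v → adj G zero (suc v))
  c+c≡c*2 : c + c ≡ c * 2
  c+c≡c*2 = trans (cong (c +_) (sym (+-identityʳ c))) (*-comm 2 c)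
  degree-sum : ∑[ u < suc N ] degree G u ≡ (c + c) + ∑[ u < N ] degree (dropVertex G) u
  degree-sum = begin
    degree G zero + ∑[ u < N ] degree G (suc u)
      ≡⟨ cong₂ _+_ (cong (λ b → (if b then 1 else 0) + c) (irrefl G zero))
                   (∑-distrib-+ (λ u → if adj G (suc u) zero then 1 else 0) (degree (dropVertex G))) ⟩
    c + (count (λ u → adj G (suc u) zero) + ∑[ u < N ] degree (dropVertex G) u)
      ≡⟨ cong (λ x → c + (x + ∑[ u < N ] degree (dropVertex G) u)) (count-cong (λ u → Graph.sym G (suc u) zero)) ⟩
    c + (c + ∑[ u < N ] degree (dropVertex G) u)
      ≡⟨ +-assoc c c _ ⟨
    (c + c) + ∑[ u < N ] degree (dropVertex G) u ∎

double-count : ∀ {N} (G : Graph N) (X Y : Fin N → Bool) →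
  ∑[ x < N ] (if X x then count (λ y → Y y ∧ adj G x y) else 0) ≡
  ∑[ y < N ] (if Y y then count (λ x → X x ∧ adj G y x) else 0)
double-count {N} G X Y = begin
  ∑[ x < N ] (if X x then count (λ y → Y y ∧ adj G x y) else 0)
    ≡⟨ sum-cong-≗ (λ x → if-count (X x) (λ y → Y y ∧ adj G x y)) ⟩
  ∑[ x < N ] count (λ y → X x ∧ (Y y ∧ adj G x y))
    ≡⟨ ∑-comm (λ x y → if X x ∧ (Y y ∧ adj G x y) then 1 else 0) ⟩
  ∑[ y < N ] count (λ x → X x ∧ (Y y ∧ adj G x y))
    ≡⟨ sum-cong-≗ (λ y → count-cong (λ x → swap (X x) (Y y) (Graph.sym G x y))) ⟩
  ∑[ y < N ] count (λ x → Y y ∧ (X x ∧ adj G y x))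
    ≡⟨ sum-cong-≗ (λ y → if-count (Y y) (λ x → X x ∧ adj G y x)) ⟨
  ∑[ y < N ] (if Y y then count (λ x → X x ∧ adj G y x) else 0) ∎
  where
  open ≡-Reasoning
  swap : ∀ a b {e e′} → e ≡ e′ → (a ∧ (b ∧ e)) ≡ (b ∧ (a ∧ e′))
  swap false false refl = refl
  swap false true  refl = refl
  swap true  false refl = refl
  swap true  true  refl = refl

⊆G-degree : ∀ {k N} {H : Graph k} {G : Graph N} (H⊆G : H ⊆G G) v → degree H v ≤ degree G (proj₁ H⊆G v)
⊆G-degree {H = H} {G} (f , f-inj , f-hom) v with count⇒distinct (adj H v) (degree H v) ≤-refl
... | g , g-inj , Hvg = distinct⇒count (adj G (f v)) (f ∘ g , g-inj ∘ f-inj , λ i → f-hom v (g i) (Hvg i))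

KStar-centre : ∀ j → suc j ≤ degree (KStar (2 + j)) zero
KStar-centre j = distinct⇒count (adj (KStar (2 + j)) zero) (suc , Fin.suc-injective , λ _ → refl)

degree⇒KStar : ∀ {N} (G : Graph N) j {u} → suc j ≤ degree G u → KStar (2 + j) ⊆G G
degree⇒KStar {N} G j {u} j<deg with count⇒distinct (adj G u) (suc j) j<deg
... | g , g-injective , u~g = f , f-injective , f-hom
  where
  f : Fin (2 + j) → Fin N
  f zero    = u
  f (suc i) = g i
  f-injective : Injective _≡_ _≡_ f
  f-injective {zero}  {zero}   _    = refl
  f-injective {zero}  {suc i}  u≡gi = ⊥-elim (edge-≢ G (u~g i) u≡gi)
  f-injective {suc i} {zero}   gi≡u = ⊥-elim (edge-≢ G (u~g i) (sym gi≡u))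
  f-injective {suc i} {suc i′} eq   = cong suc (g-injective eq)
  f-hom : ∀ a b → Edge (KStar (2 + j)) a b → Edge G (f a) (f b)
  f-hom zero    (suc b) _ = u~g b
  f-hom (suc a) zero    _ = edge-sym G (u~g a)
  f-hom (suc a) (suc b) e with () ← proj₂ (∧-split {neqb (suc a) (suc b)} e)

hub-degree : ∀ k (E : ℕ → ℕ → Bool) → (∀ (i : Fin (suc k)) → E 0 (suc (toℕ i)) ≡ true) →
  suc k ≤ degree (fromEdges (4 + k) E) zero
hub-degree k E hub-edge = distinct⇒count (adj (fromEdges (4 + k) E) zero) (ι , ι-injective , centre~ι)
  where
  ι : Fin (suc k) → Fin (4 + k)
  ι = suc ∘ inject₁ ∘ inject₁
  ι-injective : Injective _≡_ _≡_ ι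
  ι-injective = Fin.inject₁-injective ∘ Fin.inject₁-injective ∘ Fin.suc-injective
  centre~ι : ∀ i → Edge (fromEdges (4 + k) E) zero (ι i)
  centre~ι i rewrite Fin.toℕ-inject₁ (inject₁ i) | Fin.toℕ-inject₁ i | hub-edge i = refl

T1-hub : ∀ k → suc k ≤ degree (T1 (4 + k)) zero
T1-hub k = hub-degree k (T1Edge (4 + k)) λ i → ∨-introˡ (<⇒<ᵇ-true (Fin.toℕ<n i))

T2-hub : ∀ k → suc k ≤ degree (T2 (4 + k)) zero
T2-hub k = hub-degree k (T2Edge (4 + k)) λ i → ∨-introˡ (<⇒<ᵇ-true (Fin.toℕ<n i))

-- The lower bound

-- Reduction modulo N of a number below 2N, which is all that sums of two residues need.
wrap : ℕ → ℕ → ℕ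
wrap N x with x <? N
... | yes _ = x
... | no  _ = x ∸ N

wrap-< : ∀ {N x} → x < N + N → wrap N x < N
wrap-< {N} {x} x<2N with x <? N
... | yes x<N = x<N
... | no  x≮N = subst (x ∸ N <_) (m+n∸n≡m N N) (∸-monoˡ-< x<2N (≮⇒≥ x≮N))

wrap-mixed : ∀ {N a b₁ b₂} → b₂ < N → N ≤ a + b₂ → a + b₁ ≢ a + b₂ ∸ N
wrap-mixed {N} {a} {b₁} {b₂} b₂<N N≤a+b₂ a+b₁≡ = <⇒≱ b₂<N (subst (N ≤_) (sym b₂≡b₁+N) (m≤n+m N b₁))
  where
  open ≡-Reasoning
  b₂≡b₁+N : b₂ ≡ b₁ + N
  b₂≡b₁+N = +-cancelˡ-≡ a b₂ (b₁ + N) (begin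
    a + b₂          ≡⟨ m∸n+n≡m N≤a+b₂ ⟨
    a + b₂ ∸ N + N  ≡⟨ cong (_+ N) a+b₁≡ ⟨
    a + b₁ + N      ≡⟨ +-assoc a b₁ N ⟩
    a + (b₁ + N)    ∎)

wrap-cancelˡ : ∀ {N} a {b₁ b₂} → b₁ < N → b₂ < N → wrap N (a + b₁) ≡ wrap N (a + b₂) → b₁ ≡ b₂
wrap-cancelˡ {N} a {b₁} {b₂} b₁<N b₂<N eq with a + b₁ <? N | a + b₂ <? N
... | yes _   | yes _   = +-cancelˡ-≡ a b₁ b₂ eq
... | no  ≮₁  | no  ≮₂  = +-cancelˡ-≡ a b₁ b₂ (∸-cancelʳ-≡ (≮⇒≥ ≮₁) (≮⇒≥ ≮₂) eq)
... | yes _   | no  ≮₂  = ⊥-elim (wrap-mixed b₂<N (≮⇒≥ ≮₂) eq)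
... | no  ≮₁  | yes _   = ⊥-elim (wrap-mixed b₁<N (≮⇒≥ ≮₁) (sym eq))

key : ∀ N → Fin N → Fin N → ℕ
key N u v = wrap N (toℕ u + toℕ v)

key-< : ∀ N u v → key N u v < N
key-< N u v = wrap-< (+-mono-< (Fin.toℕ<n u) (Fin.toℕ<n v))

key-cancelˡ : ∀ N u {v w} → key N u v ≡ key N u w → v ≡ w
key-cancelˡ N u {v} {w} eq = Fin.toℕ-injective (wrap-cancelˡ (toℕ u) (Fin.toℕ<n v) (Fin.toℕ<n w) eq)

sumGraph : ∀ N → ℕ → Graph N
sumGraph N j = fromEdges N (λ a b → wrap N (a + b) <ᵇ j)

sumGraph-adj : ∀ N j u v → adj (sumGraph N j) u v ≡ neqb u v ∧ (key N u v <ᵇ j)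
sumGraph-adj N j u v = cong (neqb u v ∧_)
  (trans (cong ((key N u v <ᵇ j) ∨_) (cong (λ x → wrap N x <ᵇ j) (+-comm (toℕ v) (toℕ u)))) (∨-idem _))

sumGraph-edge : ∀ {N j u v} → Edge (sumGraph N j) u v → key N u v < j
sumGraph-edge {N} {j} {u} {v} uv = <ᵇ-true⇒< (proj₂ (∧-split {neqb u v} (trans (sym (sumGraph-adj N j u v)) uv)))

sumGraph-co-edge : ∀ {N j u v} → Edge (complement (sumGraph N j)) u v → j ≤ key N u v
sumGraph-co-edge {N} {j} {u} {v} uv =
  <ᵇ-false⇒≥ (trans (sym (∧-identityˡ _)) (trans (cong (_∧ (key N u v <ᵇ j)) (sym distinct))
    (trans (sym (sumGraph-adj N j u v)) (co-edge⇒¬edge (sumGraph N j) uv))))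
  where
  distinct : neqb u v ≡ true
  distinct = ≢⇒neqb (edge-≢ (complement (sumGraph N j)) uv)

sumGraph-degree : ∀ N j u → degree (sumGraph N j) u ≤ j
sumGraph-degree N j u = count-≤-injectiveOn (adj (sumGraph N j) u) (key N u)
  (λ _ → sumGraph-edge) (λ _ _ → key-cancelˡ N u)

sumGraph-co-degree : ∀ N j u → degree (complement (sumGraph N j)) u ≤ N ∸ j
sumGraph-co-degree N j u = count-≤-injectiveOn (adj (complement (sumGraph N j)) u) (λ v → key N u v ∸ j)
  (λ v uv → ∸-monoˡ-< (key-< N u v) (sumGraph-co-edge {N} {j} {u} uv))
  (λ uv uw eq → key-cancelˡ N u (∸-cancelʳ-≡ (sumGraph-co-edge {N} {j} {u} uv) (sumGraph-co-edge {N} {j} {u} uw) eq))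

sumGraph-¬Ramsey : ∀ {a b} {H₁ : Graph a} {H₂ : Graph b} {N} j {u₁ u₂} →
  j < degree H₁ u₁ → N ∸ j < degree H₂ u₂ → ¬ RamseyProp H₁ H₂ N
sumGraph-¬Ramsey {H₁ = H₁} {H₂} {N} j {u₁} {u₂} j<deg₁ N-j<deg₂ ramsey with ramsey (sumGraph N j)
... | inj₁ H₁⊆G = <⇒≱ j<deg₁ (≤-trans (⊆G-degree {H = H₁} {sumGraph N j} H₁⊆G u₁) (sumGraph-degree N j (proj₁ H₁⊆G u₁)))
... | inj₂ H₂⊆Ḡ = <⇒≱ N-j<deg₂ (≤-trans (⊆G-degree {H = H₂} {complement (sumGraph N j)} H₂⊆Ḡ u₂) (sumGraph-co-degree N j (proj₁ H₂⊆Ḡ u₂)))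

ramsey-lower : ∀ {b} {T : Graph b} j k {u} → suc k ≤ degree T u →
  ∀ N → N < suc (j + k) → ¬ RamseyProp (KStar (2 + j)) T N
ramsey-lower {T = T} j k k<deg N N≤j+k = sumGraph-¬Ramsey {H₁ = KStar (2 + j)} {T} {N} j {zero} (KStar-centre j) (≤-trans (s≤s N∸j≤k) k<deg)
  where
  N∸j≤k : N ∸ j ≤ k
  N∸j≤k = subst (N ∸ j ≤_) (m+n∸m≡n j k) (∸-monoˡ-≤ j (s≤s⁻¹ N≤j+k))

-- Spiders

-- Vertex v_t of a spider with q leaves: the centre v₀ = S[0], the leaves v₁ … v_q, and
-- v_{q+1} … v_{q+4} = S[1] … S[4].
position : ℕ → Fin 5 → ℕ
position q zero    = 0
position q (suc a) = suc (toℕ a + q)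

position-injective : ∀ q {a b} → position q a ≡ position q b → a ≡ b
position-injective q {zero}  {zero}  _  = refl
position-injective q {suc a} {suc b} eq =
  cong suc (Fin.toℕ-injective (+-cancelʳ-≡ q (toℕ a) (toℕ b) (suc-injective eq)))

leaf≢position : ∀ q (i : Fin q) a → suc (toℕ i) ≢ position q a
leaf≢position q i (suc a) eq = <⇒≱ (Fin.toℕ<n i) (subst (q ≤_) (sym (suc-injective eq)) (m≤n+m q (toℕ a)))

data Slot (q t : ℕ) : Set where
  special : (a : Fin 5) → t ≡ position q a → Slot q t
  leaf    : (i : Fin q) → t ≡ suc (toℕ i) → Slot q t

slot : ∀ q t → t < 5 + q → Slot q t
slot q zero    _       = special zero refl
slot q (suc t) t<5+q with t <? q
... | yes t<q = leaf (fromℕ< t<q) (cong suc (sym (Fin.toℕ-fromℕ< t<q)))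
... | no  t≮q = special (suc (fromℕ< t∸q<4))
                  (cong suc (sym (trans (cong (_+ q) (Fin.toℕ-fromℕ< t∸q<4)) (m∸n+n≡m (≮⇒≥ t≮q)))))
  where
  t∸q<4 : t ∸ q < 4
  t∸q<4 = subst (t ∸ q <_) (m+n∸n≡m 4 q) (∸-monoˡ-< (s≤s⁻¹ t<5+q) (≮⇒≥ t≮q))

data SpiderEdge (q : ℕ) (a₁ b₁ a₂ b₂ : Fin 5) : ℕ → ℕ → Set where
  hub    : ∀ {y} → 1 ≤ y → y ≤ 2 + q → SpiderEdge q a₁ b₁ a₂ b₂ 0 y
  first  : SpiderEdge q a₁ b₁ a₂ b₂ (position q a₁) (position q b₁)
  second : SpiderEdge q a₁ b₁ a₂ b₂ (position q a₂) (position q b₂)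

Leaves : ∀ {N k} → Graph N → Fin N → Vec (Fin N) k → ℕ → Set
Leaves {N} H c S q = Σ (Fin q → Fin N) λ g → Injective _≡_ _≡_ g × (∀ i → Edge H c (g i) × All (_≢ g i) S)

module Placement {N q} (S : Vec (Fin N) 5) (g : Fin q → Fin N) where

  place : ∀ {t} → Slot q t → Fin N
  place (special a _) = lookup S a
  place (leaf i _)    = g i

  spider : Fin (5 + q) → Fin N
  spider t = place (slot q (toℕ t) (Fin.toℕ<n t))

  place-at : ∀ {t} (s : Slot q t) a → t ≡ position q a → place s ≡ lookup S a
  place-at (special b t≡b) a t≡a = cong (lookup S) (position-injective q (trans (sym t≡b) t≡a))
  place-at (leaf i t≡i)    a t≡a = ⊥-elim (leaf≢position q i a (trans (sym t≡i) t≡a))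

  module _ (S-unique : Unique S) (g-injective : Injective _≡_ _≡_ g) (fresh : ∀ i → All (_≢ g i) S) where

    place-injective : ∀ {t₁ t₂} (s₁ : Slot q t₁) (s₂ : Slot q t₂) → place s₁ ≡ place s₂ → t₁ ≡ t₂
    place-injective (special a t≡a) (special b t≡b) eq =
      trans t≡a (trans (cong (position q) (lookup-injective S-unique a b eq)) (sym t≡b))
    place-injective (leaf i t≡i) (leaf i′ t≡i′) eq = trans t≡i (trans (cong (suc ∘ toℕ) (g-injective eq)) (sym t≡i′))
    place-injective (special a _) (leaf i _) eq = ⊥-elim (lookup⁺ (fresh i) a eq)
    place-injective (leaf i _) (special a _) eq = ⊥-elim (lookup⁺ (fresh i) a (sym eq))

    spider-injective : Injective _≡_ _≡_ spider
    spider-injective {t} {t′} eq = Fin.toℕ-injective (place-injective (slot q (toℕ t) _) (slot q (toℕ t′) _) eq)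

spider-⊆ : ∀ {N q} (H : Graph N) (S : Vec (Fin N) 5) → Unique S → Leaves H (lookup S zero) S q →
  ∀ {E a₁ b₁ a₂ b₂} → (∀ x y → E x y ≡ true → SpiderEdge q a₁ b₁ a₂ b₂ x y) →
  Edge H (lookup S zero) (lookup S (# 1)) → Edge H (lookup S zero) (lookup S (# 2)) →
  Edge H (lookup S a₁) (lookup S b₁) → Edge H (lookup S a₂) (lookup S b₂) →
  fromEdges (5 + q) E ⊆G H
spider-⊆ {N} {q} H S S-unique (g , g-injective , leaf-ok) {E} {a₁} {b₁} {a₂} {b₂} spiderEdge c~x₁ c~x₂ e₁ e₂ =
  spider , spider-injective S-unique g-injective (proj₂ ∘ leaf-ok) , homomorphism
  where
  open Placement S g
  place-edge : ∀ {t₁ t₂} (s₁ : Slot q t₁) (s₂ : Slot q t₂) → SpiderEdge q a₁ b₁ a₂ b₂ t₁ t₂ →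
    Edge H (place s₁) (place s₂)
  place-edge s₁ s₂ (hub 1≤y y≤2+q) rewrite place-at s₁ zero refl = from-centre s₂ 1≤y y≤2+q
    where
    from-centre : ∀ {y} (s : Slot q y) → 1 ≤ y → y ≤ 2 + q → Edge H (lookup S zero) (place s)
    from-centre (leaf i _) _ _ = proj₁ (leaf-ok i)
    from-centre (special zero refl) () _
    from-centre (special (suc zero) _) _ _ = c~x₁
    from-centre (special (suc (suc zero)) _) _ _ = c~x₂
    from-centre (special (suc (suc (suc a))) refl) _ y≤2+q =
      ⊥-elim (<⇒≱ (s≤s (s≤s (s≤s (m≤n+m q (toℕ a))))) y≤2+q)
  place-edge s₁ s₂ first  rewrite place-at s₁ a₁ refl | place-at s₂ b₁ refl = e₁
  place-edge s₁ s₂ second rewrite place-at s₁ a₂ refl | place-at s₂ b₂ refl = e₂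
  directed : ∀ u v → E (toℕ u) (toℕ v) ≡ true → Edge H (spider u) (spider v)
  directed u v e = place-edge (slot q (toℕ u) _) (slot q (toℕ v) _) (spiderEdge (toℕ u) (toℕ v) e)
  homomorphism : ∀ u v → Edge (fromEdges (5 + q) E) u v → Edge H (spider u) (spider v)
  homomorphism u v uv with ∨-split (proj₂ (∧-split {neqb u v} uv))
  ... | inj₁ e = directed u v e
  ... | inj₂ e = edge-sym H (directed v u e)

hub-spiderEdge : ∀ q {a₁ b₁ a₂ b₂ x y} → ((x ≡ᵇ 0) ∧ ((1 ≤ᵇ y) ∧ (y ≤ᵇ 2 + q))) ≡ true →
  SpiderEdge q a₁ b₁ a₂ b₂ x y
hub-spiderEdge q {x = x} {y} e with ∧-split {x ≡ᵇ 0} e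
... | x≡0 , y-range with ≡ᵇ-true⇒≡ {x} x≡0 | ∧-split {1 ≤ᵇ y} y-range
...   | refl | 1≤y , y≤2+q = hub (≤ᵇ-true⇒≤ 1≤y) (≤ᵇ-true⇒≤ y≤2+q)

pair-≡ : ∀ {x y x′ y′} → ((x ≡ᵇ x′) ∧ (y ≡ᵇ y′)) ≡ true → x ≡ x′ × y ≡ y′
pair-≡ {x} {x′ = x′} e with ∧-split {x ≡ᵇ x′} e
... | x≡ , y≡ = ≡ᵇ-true⇒≡ x≡ , ≡ᵇ-true⇒≡ y≡

T1-spiderEdge : ∀ q x y → T1Edge (5 + q) x y ≡ true → SpiderEdge q (# 1) (# 3) (# 2) (# 4) x y
T1-spiderEdge q x y e with ∨-split e
... | inj₁ e-hub = hub-spiderEdge q e-hub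
... | inj₂ e-pairs with ∨-split e-pairs
...   | inj₁ e₁ with pair-≡ {x} {y} {suc q} {3 + q} e₁
...     | refl , refl = first
T1-spiderEdge q x y e | inj₂ e-pairs | inj₂ e₂ with pair-≡ {x} {y} {2 + q} {4 + q} e₂
...     | refl , refl = second

T2-spiderEdge : ∀ q x y → T2Edge (5 + q) x y ≡ true → SpiderEdge q (# 2) (# 3) (# 2) (# 4) x y
T2-spiderEdge q x y e with ∨-split e
... | inj₁ e-hub = hub-spiderEdge q e-hub
... | inj₂ e-pairs with ∨-split e-pairs
...   | inj₁ e₁ with pair-≡ {x} {y} {2 + q} {3 + q} e₁
...     | refl , refl = first
T2-spiderEdge q x y e | inj₂ e-pairs | inj₂ e₂ with pair-≡ {x} {y} {2 + q} {4 + q} e₂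
...     | refl , refl = second

T1-⊆ : ∀ {N} (H : Graph N) q {c x₁ x₂ y₁ y₂ : Fin N} → Unique (c ∷ x₁ ∷ x₂ ∷ y₁ ∷ y₂ ∷ []) →
  Leaves H c (c ∷ x₁ ∷ x₂ ∷ y₁ ∷ y₂ ∷ []) q →
  Edge H c x₁ → Edge H c x₂ → Edge H x₁ y₁ → Edge H x₂ y₂ → T1 (5 + q) ⊆G H
T1-⊆ H q unique leaves c~x₁ c~x₂ x₁~y₁ x₂~y₂ = spider-⊆ H _ unique leaves (T1-spiderEdge q) c~x₁ c~x₂ x₁~y₁ x₂~y₂

T2-⊆ : ∀ {N} (H : Graph N) q {c x₁ x₂ y₁ y₂ : Fin N} → Unique (c ∷ x₁ ∷ x₂ ∷ y₁ ∷ y₂ ∷ []) →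
  Leaves H c (c ∷ x₁ ∷ x₂ ∷ y₁ ∷ y₂ ∷ []) q →
  Edge H c x₁ → Edge H c x₂ → Edge H x₂ y₁ → Edge H x₂ y₂ → T2 (5 + q) ⊆G H
T2-⊆ H q unique leaves c~x₁ c~x₂ x₂~y₁ x₂~y₂ = spider-⊆ H _ unique leaves (T2-spiderEdge q) c~x₁ c~x₂ x₂~y₁ x₂~y₂

leaves : ∀ {N k l} (H : Graph N) c q (xs : Vec (Fin N) k) (ys : Vec (Fin N) l) →
  k + q ≤ degree H c → (∀ {v} → Edge H c v → All (_≢ v) ys) → Leaves H c (c ∷ xs ++ ys) q
leaves {k = k} H c q xs ys bound ys-fresh with chooseMany q (adj H c) xs (subst (_≤ degree H c) (+-comm k q) bound)
... | g , g-injective , g∈ = g , g-injective , λ i → fresh (∖-sound xs (g∈ i))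
  where
  fresh : ∀ {v} → Edge H c v × All (_≢ v) xs → Edge H c v × All (_≢ v) (c ∷ xs ++ ys)
  fresh (c~v , xs-fresh) = c~v , edge-≢ H c~v ∷ ++⁺ xs-fresh (ys-fresh c~v)

-- The upper bound

regular-degree : ∀ {a b j k} → a ≤ j → b ≤ k → suc (a + b) ≡ suc (j + k) → a ≡ j
regular-degree {a} {b} {j} {k} a≤j b≤k eq = ≤-antisym a≤j (+-cancelʳ-≤ k j a (begin
  j + k  ≡⟨ suc-injective eq ⟨
  a + b  ≤⟨ +-monoʳ-≤ a b≤k ⟩
  a + k  ∎))
  where open ≤-Reasoning

ramsey-upper : ∀ j k {b} {T : Graph b} → ¬ 2 ∣ suc (j + k) * j →
  (∀ (G : Graph (suc (j + k))) → (∀ v → degree G v ≤ j) → ∀ c → k < degree (complement G) c → T ⊆G complement G) →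
  RamseyProp (KStar (2 + j)) T (suc (j + k))
ramsey-upper j k odd grow G with Fin.any? (λ u → suc j ≤? degree G u)
... | yes (u , j<deg) = inj₁ (degree⇒KStar G j j<deg)
... | no  no-star with Fin.any? (λ c → suc k ≤? degree (complement G) c)
...   | yes (c , k<co) = inj₂ (grow G sparse c k<co)
  where
  sparse : ∀ v → degree G v ≤ j
  sparse v = ≮⇒≥ λ j<deg → no-star (v , j<deg)
...   | no  no-centre = ⊥-elim (odd (subst (2 ∣_) regular (handshake G)))
  where
  regular : ∑[ u < suc (j + k) ] degree G u ≡ suc (j + k) * j
  regular = trans (sum-cong-≗ λ u → regular-degree (≮⇒≥ λ j<deg → no-star (u , j<deg))
                                                   (≮⇒≥ λ k<co → no-centre (u , k<co)) (degree-complement G u))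
                  (∑-const (suc (j + k)) j)

between : ∀ {k d} → k < d → d ≤ 2 + k → d ≡ suc k ⊎ d ≡ 2 + k
between k<d d≤2+k with m≤n⇒m<n∨m≡n d≤2+k
... | inj₁ d<2+k = inj₁ (≤-antisym (s≤s⁻¹ d<2+k) k<d)
... | inj₂ d≡2+k = inj₂ d≡2+k

neighbours-lower : ∀ {μ d j k} → μ + d ≡ j + k → d ≤ 2 + k → j ≤ 2 + μ
neighbours-lower {μ} {d} {j} {k} μ+d d≤2+k = +-cancelʳ-≤ k j (2 + μ) (begin
  j + k          ≡⟨ μ+d ⟨
  μ + d          ≤⟨ +-monoʳ-≤ μ d≤2+k ⟩
  μ + (2 + k)    ≡⟨ +-assoc μ 2 k ⟨
  μ + 2 + k      ≡⟨ cong (_+ k) (+-comm μ 2) ⟩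
  2 + μ + k      ∎)
  where open ≤-Reasoning

averaging-contradiction : ∀ p r {d μ} → μ + d ≡ (5 + p) + ((5 + p) + r) →
  d ≡ 6 + p + r ⊎ d ≡ 7 + p + r → ¬ (d * μ + μ ≤ μ * (5 + p) + d)
averaging-contradiction p r {μ = μ} μ+d (inj₁ refl) =
  impossible (+-cancelʳ-≡ (6 + p + r) μ (4 + p) (trans μ+d (split p r)))
  where
  split : ∀ p r → (5 + p) + ((5 + p) + r) ≡ (4 + p) + (6 + p + r)
  split = solve-∀
  excess : ∀ p r → (6 + p + r) * (4 + p) + (4 + p) ≡ ((4 + p) * (5 + p) + (6 + p + r)) + suc (suc (p + 3 * r + p * r))
  excess = solve-∀
  impossible : μ ≡ 4 + p → ¬ ((6 + p + r) * μ + μ ≤ μ * (5 + p) + (6 + p + r))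
  impossible refl bound = m+1+n≰m _ (subst (_≤ (4 + p) * (5 + p) + (6 + p + r)) (excess p r) bound)
averaging-contradiction p r {μ = μ} μ+d (inj₂ refl) =
  impossible (+-cancelʳ-≡ (7 + p + r) μ (3 + p) (trans μ+d (split p r)))
  where
  split : ∀ p r → (5 + p) + ((5 + p) + r) ≡ (3 + p) + (7 + p + r)
  split = solve-∀
  excess : ∀ p r → (7 + p + r) * (3 + p) + (3 + p) ≡ ((3 + p) * (5 + p) + (7 + p + r)) + suc (suc (2 * p + 2 * r + p * r))
  excess = solve-∀
  impossible : μ ≡ 3 + p → ¬ ((7 + p + r) * μ + μ ≤ μ * (5 + p) + (7 + p + r))
  impossible refl bound = m+1+n≰m _ (subst (_≤ (3 + p) * (5 + p) + (7 + p + r)) (excess p r) bound)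

module _ (p r : ℕ) where

  -- j = m − 2, k = n − 4 and n = 5 + q.
  j k q : ℕ
  j = 5 + p
  k = j + r
  q = 4 + p + r

  -- N is kept abstract, its value given by order, so that sums over Fin N do not unfold.
  module Centre {N} (G : Graph N) (order : N ≡ suc (j + k)) (sparse : ∀ v → degree G v ≤ j) (c : Fin N) where

    H : Graph N
    H = complement G

    A M : Fin N → Bool
    A = adj H c
    M = adj G c

    d μ : ℕ
    d = degree H c
    μ = degree G c

    co-degree : ∀ v → k ≤ degree H v
    co-degree v = +-cancelˡ-≤ j k (degree H v)
      (≤-trans (≤-reflexive (sym (suc-injective (trans (degree-complement G v) order)))) (+-monoˡ-≤ (degree H v) (sparse v)))

    μ+d : μ + d ≡ j + k
    μ+d = suc-injective (trans (degree-complement G c) order)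

    apart : ∀ {x w} → Edge H c x → Edge G c w → x ≢ w
    apart {x} c~x c~w refl with () ← trans (sym (co-edge⇒¬edge G c~x)) c~w

    A-neighbours : ∀ {w} → Edge G c w → suc (count (λ v → A v ∧ adj G w v)) ≤ j
    A-neighbours {w} c~w = ≤-trans
      (count-< {P = λ v → A v ∧ adj G w v} {adj G w} {c} (λ v → proj₂ ∘ ∧-split) (edge-sym G c~w)
        (cong (_∧ adj G w c) (irrefl H c)))
      (sparse w)

    two-in-A : k < d → ∀ {w} → Edge G c w → 2 ≤ count (λ v → A v ∧ adj H w v)
    two-in-A k<d {w} c~w = +-cancelˡ-≤ j 2 Y (begin
      j + 2      ≡⟨ +-comm j 2 ⟩
      2 + j      ≤⟨ s≤s (s≤s (m≤m+n j r)) ⟩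
      2 + k      ≤⟨ s≤s k<d ⟩
      suc d      ≡⟨ cong suc (count-split-neighbours G A (w∉A)) ⟩
      suc X + Y  ≤⟨ +-monoˡ-≤ Y (A-neighbours c~w) ⟩
      j + Y      ∎)
      where
      open ≤-Reasoning
      X Y : ℕ
      X = count (λ v → A v ∧ adj G w v)
      Y = count (λ v → A v ∧ adj H w v)
      w∉A : A w ≡ false
      w∉A with A w in Aw
      ... | false = refl
      ... | true  = ⊥-elim (apart Aw c~w refl)

    -- d (μ − 1) ≤ #edges(A, M) ≤ μ (j − 1), with the subtractions moved across.
    averaging : (∀ x → A x ≡ true → count (λ w → M w ∧ adj H x w) ≤ 1) → d * μ + μ ≤ μ * j + d
    averaging sparse-to-M = begin
      d * μ + μ  ≤⟨ +-monoˡ-≤ μ lower ⟩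
      e + d + μ  ≡⟨ +-assoc e d μ ⟩
      e + (d + μ) ≡⟨ cong (e +_) (+-comm d μ) ⟩
      e + (μ + d) ≡⟨ +-assoc e μ d ⟨
      e + μ + d  ≤⟨ +-monoˡ-≤ d upper ⟩
      μ * j + d  ∎
      where
      open ≤-Reasoning
      e : ℕ
      e = ∑[ x < N ] (if A x then count (λ w → M w ∧ adj G x w) else 0)
      from-A : ∀ x → (if A x then μ else 0) ≤ (if A x then count (λ w → M w ∧ adj G x w) else 0) + (if A x then 1 else 0)
      from-A x with A x in Ax
      ... | false = z≤n
      ... | true  = ≤-trans (≤-reflexive (count-split-neighbours G M (co-edge⇒¬edge G Ax)))
                            (+-monoʳ-≤ _ (sparse-to-M x Ax))
      from-M : ∀ w → (if M w then count (λ x → A x ∧ adj G w x) else 0) + (if M w then 1 else 0) ≤ (if M w then j else 0)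
      from-M w with M w in Mw
      ... | false = z≤n
      ... | true  = ≤-trans (≤-reflexive (+-comm _ 1)) (A-neighbours Mw)
      lower : d * μ ≤ e + d
      lower = begin
        d * μ   ≡⟨ ∑-indicator A μ ⟨
        ∑[ x < N ] (if A x then μ else 0)
                ≤⟨ sum-mono-≤ from-A ⟩
        ∑[ x < N ] ((if A x then count (λ w → M w ∧ adj G x w) else 0) + (if A x then 1 else 0))
                ≡⟨ ∑-distrib-+ (λ x → if A x then count (λ w → M w ∧ adj G x w) else 0) (λ x → if A x then 1 else 0) ⟩
        e + d   ∎
      upper : e + μ ≤ μ * j
      upper = begin
        e + μ   ≡⟨ cong (_+ μ) (double-count G A M) ⟩
        ∑[ w < N ] (if M w then count (λ x → A x ∧ adj G w x) else 0) + μ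
                ≡⟨ ∑-distrib-+ (λ w → if M w then count (λ x → A x ∧ adj G w x) else 0) (λ w → if M w then 1 else 0) ⟨
        ∑[ w < N ] ((if M w then count (λ x → A x ∧ adj G w x) else 0) + (if M w then 1 else 0))
                ≤⟨ sum-mono-≤ from-M ⟩
        ∑[ w < N ] (if M w then j else 0)
                ≡⟨ ∑-indicator M j ⟩
        μ * j   ∎

    two-in-M : k < d → d ≤ 2 + k → ∃ λ x → A x ≡ true × 2 ≤ count (λ w → M w ∧ adj H x w)
    two-in-M k<d d≤2+k with Fin.any? (λ x → (A x Bool.≟ true) ×-dec (2 ≤? count (λ w → M w ∧ adj H x w)))
    ... | yes found = found
    ... | no  none  = ⊥-elim (averaging-contradiction p r μ+d (between k<d d≤2+k) (averaging at-most-one))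
      where
      at-most-one : ∀ x → A x ≡ true → count (λ w → M w ∧ adj H x w) ≤ 1
      at-most-one x Ax = s≤s⁻¹ (≰⇒> λ two → none (x , Ax , two))

    two-neighbours : d ≤ 2 + k → 2 ≤ μ
    two-neighbours d≤2+k = ≤-trans (s≤s (s≤s z≤n)) (+-cancelˡ-≤ 2 (3 + p) μ (neighbours-lower μ+d d≤2+k))

    greedy-T1 : 4 + q ≤ d → T1 (5 + q) ⊆G H
    greedy-T1 big with choose A [] (≤-trans (s≤s z≤n) big)
    ... | x₁ , c~x₁ , [] with choose (adj H x₁) (c ∷ []) (≤-trans (s≤s (s≤s z≤n)) (co-degree x₁))
    ... | y₁ , x₁~y₁ , c≢y₁ ∷ [] with choose A (x₁ ∷ y₁ ∷ []) (≤-trans (s≤s (s≤s (s≤s z≤n))) big)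
    ... | x₂ , c~x₂ , x₁≢x₂ ∷ y₁≢x₂ ∷ []
      with choose (adj H x₂) (c ∷ x₁ ∷ y₁ ∷ []) (≤-trans (s≤s (s≤s (s≤s (s≤s z≤n)))) (co-degree x₂))
    ... | y₂ , x₂~y₂ , c≢y₂ ∷ x₁≢y₂ ∷ y₁≢y₂ ∷ [] =
      T1-⊆ H q unique (leaves H c q (x₁ ∷ x₂ ∷ y₁ ∷ y₂ ∷ []) [] big (λ _ → [])) c~x₁ c~x₂ x₁~y₁ x₂~y₂
      where
      unique : Unique (c ∷ x₁ ∷ x₂ ∷ y₁ ∷ y₂ ∷ [])
      unique = (edge-≢ H c~x₁ ∷ edge-≢ H c~x₂ ∷ c≢y₁ ∷ c≢y₂ ∷ [])
             ∷ (x₁≢x₂ ∷ edge-≢ H x₁~y₁ ∷ x₁≢y₂ ∷ [])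
             ∷ (≢-sym y₁≢x₂ ∷ edge-≢ H x₂~y₂ ∷ [])
             ∷ (y₁≢y₂ ∷ [])
             ∷ [] ∷ []

    greedy-T2 : 4 + q ≤ d → T2 (5 + q) ⊆G H
    greedy-T2 big with choose A [] (≤-trans (s≤s z≤n) big)
    ... | x₂ , c~x₂ , [] with choose (adj H x₂) (c ∷ []) (≤-trans (s≤s (s≤s z≤n)) (co-degree x₂))
    ... | y₁ , x₂~y₁ , c≢y₁ ∷ [] with choose (adj H x₂) (c ∷ y₁ ∷ []) (≤-trans (s≤s (s≤s (s≤s z≤n))) (co-degree x₂))
    ... | y₂ , x₂~y₂ , c≢y₂ ∷ y₁≢y₂ ∷ []
      with choose A (x₂ ∷ y₁ ∷ y₂ ∷ []) (≤-trans (s≤s (s≤s (s≤s (s≤s z≤n)))) big)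
    ... | x₁ , c~x₁ , x₂≢x₁ ∷ y₁≢x₁ ∷ y₂≢x₁ ∷ [] =
      T2-⊆ H q unique (leaves H c q (x₁ ∷ x₂ ∷ y₁ ∷ y₂ ∷ []) [] big (λ _ → [])) c~x₁ c~x₂ x₂~y₁ x₂~y₂
      where
      unique : Unique (c ∷ x₁ ∷ x₂ ∷ y₁ ∷ y₂ ∷ [])
      unique = (edge-≢ H c~x₁ ∷ edge-≢ H c~x₂ ∷ c≢y₁ ∷ c≢y₂ ∷ [])
             ∷ (≢-sym x₂≢x₁ ∷ ≢-sym y₁≢x₁ ∷ ≢-sym y₂≢x₁ ∷ [])
             ∷ (edge-≢ H x₂~y₁ ∷ edge-≢ H x₂~y₂ ∷ [])
             ∷ (y₁≢y₂ ∷ [])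
             ∷ [] ∷ []

    arms-T1 : k < d → d ≤ 2 + k → T1 (5 + q) ⊆G H
    arms-T1 k<d d≤2+k with choose M [] (≤-trans (s≤s z≤n) (two-neighbours d≤2+k))
    ... | w₁ , c~w₁ , [] with choose M (w₁ ∷ []) (two-neighbours d≤2+k)
    ... | w₂ , c~w₂ , w₁≢w₂ ∷ [] with choose (λ v → A v ∧ adj H w₁ v) [] (≤-trans (s≤s z≤n) (two-in-A k<d c~w₁))
    ... | x₁ , x₁∈ , [] with choose (λ v → A v ∧ adj H w₂ v) (x₁ ∷ []) (two-in-A k<d c~w₂)
    ... | x₂ , x₂∈ , x₁≢x₂ ∷ [] with ∧-split {A x₁} x₁∈ | ∧-split {A x₂} x₂∈
    ... | c~x₁ , w₁~x₁ | c~x₂ , w₂~x₂ =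
      T1-⊆ H q unique (leaves H c q (x₁ ∷ x₂ ∷ []) (w₁ ∷ w₂ ∷ []) k<d fresh)
        c~x₁ c~x₂ (edge-sym H {w₁} w₁~x₁) (edge-sym H {w₂} w₂~x₂)
      where
      fresh : ∀ {v} → Edge H c v → All (_≢ v) (w₁ ∷ w₂ ∷ [])
      fresh c~v = ≢-sym (apart c~v c~w₁) ∷ ≢-sym (apart c~v c~w₂) ∷ []
      unique : Unique (c ∷ x₁ ∷ x₂ ∷ w₁ ∷ w₂ ∷ [])
      unique = (edge-≢ H c~x₁ ∷ edge-≢ H c~x₂ ∷ edge-≢ G c~w₁ ∷ edge-≢ G c~w₂ ∷ [])
             ∷ (x₁≢x₂ ∷ apart c~x₁ c~w₁ ∷ apart c~x₁ c~w₂ ∷ [])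
             ∷ (apart c~x₂ c~w₁ ∷ apart c~x₂ c~w₂ ∷ [])
             ∷ (w₁≢w₂ ∷ [])
             ∷ [] ∷ []

    arms-T2 : k < d → d ≤ 2 + k → T2 (5 + q) ⊆G H
    arms-T2 k<d d≤2+k with two-in-M k<d d≤2+k
    ... | x₂ , c~x₂ , two with choose (λ w → M w ∧ adj H x₂ w) [] (≤-trans (s≤s z≤n) two)
    ... | y₁ , y₁∈ , [] with choose (λ w → M w ∧ adj H x₂ w) (y₁ ∷ []) two
    ... | y₂ , y₂∈ , y₁≢y₂ ∷ [] with choose A (x₂ ∷ []) (≤-trans (s≤s (s≤s z≤n)) k<d)
    ... | x₁ , c~x₁ , x₂≢x₁ ∷ [] with ∧-split {M y₁} y₁∈ | ∧-split {M y₂} y₂∈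
    ... | c~y₁ , x₂~y₁ | c~y₂ , x₂~y₂ =
      T2-⊆ H q unique (leaves H c q (x₁ ∷ x₂ ∷ []) (y₁ ∷ y₂ ∷ []) k<d fresh) c~x₁ c~x₂ x₂~y₁ x₂~y₂
      where
      fresh : ∀ {v} → Edge H c v → All (_≢ v) (y₁ ∷ y₂ ∷ [])
      fresh c~v = ≢-sym (apart c~v c~y₁) ∷ ≢-sym (apart c~v c~y₂) ∷ []
      unique : Unique (c ∷ x₁ ∷ x₂ ∷ y₁ ∷ y₂ ∷ [])
      unique = (edge-≢ H c~x₁ ∷ edge-≢ H c~x₂ ∷ edge-≢ G c~y₁ ∷ edge-≢ G c~y₂ ∷ [])
             ∷ (≢-sym x₂≢x₁ ∷ apart c~x₁ c~y₁ ∷ apart c~x₁ c~y₂ ∷ [])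
             ∷ (apart c~x₂ c~y₁ ∷ apart c~x₂ c~y₂ ∷ [])
             ∷ (y₁≢y₂ ∷ [])
             ∷ [] ∷ []

    T1-around : k < d → T1 (5 + q) ⊆G H
    T1-around k<d with 4 + q ≤? d
    ... | yes big   = greedy-T1 big
    ... | no  small = arms-T1 k<d (s≤s⁻¹ (≰⇒> small))

    T2-around : k < d → T2 (5 + q) ⊆G H
    T2-around k<d with 4 + q ≤? d
    ... | yes big   = greedy-T2 big
    ... | no  small = arms-T2 k<d (s≤s⁻¹ (≰⇒> small))

  star-spider-ramsey : ¬ 2 ∣ suc (j + k) * j →
    IsRamseyNumber (KStar (2 + j)) (T1 (4 + k)) (suc (j + k)) ×
    IsRamseyNumber (KStar (2 + j)) (T2 (4 + k)) (suc (j + k))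
  star-spider-ramsey odd =
    (s≤s z≤n , ramsey-upper j k {T = T1 (4 + k)} odd (λ G sparse c → Centre.T1-around G refl sparse c) ,
     λ N _ → ramsey-lower {T = T1 (4 + k)} j k {zero} (T1-hub k) N) ,
    (s≤s z≤n , ramsey-upper j k {T = T2 (4 + k)} odd (λ G sparse c → Centre.T2-around G refl sparse c) ,
     λ N _ → ramsey-lower {T = T2 (4 + k)} j k {zero} (T2-hub k) N)

odd-form : ∀ {x} → ¬ 2 ∣ x → x ≡ 1 + x / 2 * 2
odd-form {x} ¬2∣x with x % 2 | m%n<n x 2 | m≡m%n+[m/n]*n x 2
... | 0           | _              | x≡ = ⊥-elim (¬2∣x (divides (x / 2) x≡))
... | 1           | _              | x≡ = x≡
... | suc (suc _) | s≤s (s≤s ()) | _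

¬2∣odd : ∀ a → ¬ 2 ∣ 1 + a * 2
¬2∣odd a 2∣odd = 1≢0 (trans (sym ([m+kn]%n≡m%n 1 a 2)) (n∣m⇒m%n≡0 (1 + a * 2) 2 2∣odd))
  where
  1≢0 : 1 ≢ 0
  1≢0 ()

odd-gap : ∀ {x y} → ¬ 2 ∣ x → ¬ 2 ∣ y → x < y → ∃ λ t → y ≡ 2 + x + t * 2
odd-gap {x} {y} ¬2∣x ¬2∣y x<y = b ∸ suc a , (begin
  y                              ≡⟨ odd-form ¬2∣y ⟩
  1 + b * 2                      ≡⟨ cong (λ b → 1 + b * 2) (m+[n∸m]≡n a<b) ⟨
  1 + (suc a + (b ∸ suc a)) * 2  ≡⟨ shift a (b ∸ suc a) ⟩
  2 + (1 + a * 2) + (b ∸ suc a) * 2 ≡⟨ cong (λ x → 2 + x + (b ∸ suc a) * 2) (odd-form ¬2∣x) ⟨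
  2 + x + (b ∸ suc a) * 2        ∎)
  where
  open ≡-Reasoning
  a b : ℕ
  a = x / 2
  b = y / 2
  a<b : a < b
  a<b = *-cancelʳ-< 2 a b (s≤s⁻¹ (subst₂ _<_ (odd-form ¬2∣x) (odd-form ¬2∣y) x<y))
  shift : ∀ a t → 1 + (suc a + t) * 2 ≡ 2 + (1 + a * 2) + t * 2
  shift = solve-∀

odd-ramsey : ∀ m n → (∃ λ s → m ≡ 2 + 5 + s * 2) → (∃ λ t → n ≡ 2 + m + t * 2) →
  IsRamseyNumber (KStar m) (T1 n) (m + n ∸ 5) × IsRamseyNumber (KStar m) (T2 n) (m + n ∸ 5)
odd-ramsey _ _ (s , refl) (t , refl) =
  subst (λ N → IsRamseyNumber (KStar (7 + s * 2)) (T1 (9 + s * 2 + t * 2)) N ×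
               IsRamseyNumber (KStar (7 + s * 2)) (T2 (9 + s * 2 + t * 2)) N)
        (order s t) (star-spider-ramsey (s * 2) (t * 2) (subst (¬_ ∘ (2 ∣_)) (sym (product s t)) (¬2∣odd (27 + 21 * s + 5 * t + 4 * s * s + 2 * s * t))))
  where
  order : ∀ s t → suc ((5 + s * 2) + ((5 + s * 2) + t * 2)) ≡ 2 + (s * 2 + (9 + s * 2 + t * 2))
  order = solve-∀
  product : ∀ s t → suc ((5 + s * 2) + ((5 + s * 2) + t * 2)) * (5 + s * 2)
                    ≡ 1 + (27 + 21 * s + 5 * t + 4 * s * s + 2 * s * t) * 2
  product = solve-∀

theorem4p3 : (m n : ℕ) → 6 ≤ m → m < n → ¬ (2 ∣ m * n) →
    IsRamseyNumber (KStar m) (T1 n) (m + n ∸ 5) × IsRamseyNumber (KStar m) (T2 n) (m + n ∸ 5)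
theorem4p3 m n 6≤m m<n ¬2∣mn = odd-ramsey m n (odd-gap ¬2∣5 ¬2∣m 6≤m) (odd-gap ¬2∣m ¬2∣n m<n)
  where
  ¬2∣5 : ¬ 2 ∣ 5
  ¬2∣5 = ¬2∣odd 2
  ¬2∣m : ¬ 2 ∣ m
  ¬2∣m 2∣m = ¬2∣mn (∣m⇒∣m*n n 2∣m)
  ¬2∣n : ¬ 2 ∣ n
  ¬2∣n 2∣n = ¬2∣mn (∣n⇒∣m*n m 2∣n)
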